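{- Let $b\geq 2$ and let $c,\hat c\geq 0$ be integers lying in a common oasis base $b$ (i.e., for every integer $t$ between $c$ and $\hat c$ inclusive, $S_{[t,b]}$ has a fixed point). Let $a,\hat a\in\mathbb{Z}^+$ satisfy $S_{[c,b]}(a)=a$ and $S_{[\hat c,b]}(\hat a)=\hat a$. Writing $a=\sum_{i\ge 0} a_i b^i$ and $\hat a=\sum_{i\ge0}\hat a_i b^i$ with $0\le a_i,\hat a_i\le b-1$ (base $b$ expansions, with $a_i=0$, $\hat a_i=0$ for all sufficiently large $i$), we have $a_i=\hat a_i$ for every $i\geq 3$.
   Context: For integers $c\geq 0$ and $b\geq 2$, the augmented generalized happy function $S_{[c,b]}:\mathbb{Z}^+\to\mathbb{Z}^+$ is defined by $S_{[c,b]}\left(\sum_{i=0}^n a_i b^i\right)=c+\sum_{i=0}^n a_i^2$, where $0\le a_i\le b-1$, $a_n\neq 0$ (the base $b$ expansion). A positive integer $a$ is a fixed point of $S_{[c,b]}$ if $S_{[c,b]}(a)=a$. An oasis base $b$ is a set of consecutive non-negative integers $c$ such that for each of them $S_{[c,b]}$ has at least one fixed point. -}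

module Defs where

open import Data.Nat using (ℕ; zero; suc; _+_; _*_; _^_; _≤_; _<_)
open import Data.Nat.DivMod using (_/_; _%_)
open import Data.Product using (∃-syntax; _×_)
open import Data.Sum using (_⊎_)
open import Relation.Binary.PropositionalEquality using (_≡_)

-- sum of squares of base-b digits of n, computed with fuel
-- (fuel ≥ n suffices, since n / b < n for n > 0 and b ≥ 2).
-- Only meaningful for b ≥ 2; for b < 2 it returns 0.
sumSqDigitsFuel : ℕ → ℕ → ℕ → ℕ
sumSqDigitsFuel zero b n = 0
sumSqDigitsFuel (suc fuel) (suc (suc k)) zero = 0
sumSqDigitsFuel (suc fuel) (suc (suc k)) n@(suc _) =
  (n % suc (suc k)) * (n % suc (suc k)) + sumSqDigitsFuel fuel (suc (suc k)) (n / suc (suc k))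
sumSqDigitsFuel (suc fuel) _ n = 0

S : ℕ → ℕ → ℕ → ℕ
S c b n = c + sumSqDigitsFuel n b n

IsFixedPoint : ℕ → ℕ → ℕ → Set
IsFixedPoint c b a = 1 ≤ a × S c b a ≡ a

HasFixedPoint : ℕ → ℕ → Set
HasFixedPoint c b = ∃[ a ] IsFixedPoint c b a

digit : ℕ → ℕ → ℕ → ℕ
digit (suc (suc k)) zero n = n % suc (suc k)
digit (suc (suc k)) (suc i) n = digit (suc (suc k)) i (n / suc (suc k))
digit _ i n = 0

InCommonOasis : ℕ → ℕ → ℕ → Set
InCommonOasis b c ĉ = ∀ t → ((c ≤ t × t ≤ ĉ) ⊎ (ĉ ≤ t × t ≤ c)) → HasFixedPoint t b

{-# OPTIONS --safe #-}
-- Write a fixed point a of S_[c,b] as a = L + b³·H, where L collects the three lowest digits and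
-- H = ⌊a / b³⌋. Then c + s(H) = a − (sum of squares of the low digits), where s is the sum of squares
-- of digits, so c + s(H) lies in a window [b³H − lowSlack, b³H + highSlack] whose width depends on b
-- only. Since s(n + 1) ≤ s(n) + 2b − 3, the map H ↦ b³H − s(H) increases by more than that width at
-- every step. So if c and ĉ had fixed points with heads H < Ĥ, the value t just above
-- the window of H would satisfy c ≤ t ≤ ĉ and lie in no window at all, i.e. S_[t,b] would have no
-- fixed point, against the oasis hypothesis. Hence the heads agree, and with them all digits ≥ 3.
module Submission where

open import Defs
open import Data.Nat using (ℕ; zero; suc; _+_; _*_; _∸_; _≤_; _<_; z≤n; s≤s; s≤s⁻¹; z<s; _≤?_)
open import Data.Nat.Properties
open import Data.Nat.DivMod
open import Data.Nat.Divisibility using (n∣m*n)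
open import Data.Nat.Induction using (<-rec)
open import Data.Nat.Tactic.RingSolver using (solve-∀)
open import Algebra.Properties.CommutativeSemigroup +-commutativeSemigroup using (xy∙z≈xz∙y; x∙yz≈xz∙y; xy∙z≈z∙yx)
open import Data.Product using (_×_; _,_; ∃-syntax)
open import Data.Sum using (inj₁; inj₂; swap)
open import Function using (_∘_)
open import Relation.Nullary using (¬_; Dec; yes; no)
open import Relation.Binary.PropositionalEquality using (_≡_; refl; sym; trans; cong; cong₂; subst; module ≡-Reasoning)

bounds-from-balance : ∀ {z q l x lo hi} → z + q ≡ l + x → q ≤ l + lo → l ≤ q + hi →
                      x ≤ z + lo × z ≤ x + hi
bounds-from-balance {z} {q} {l} {x} {lo} {hi} balance q≤ l≤ =
  +-cancelʳ-≤ l x (z + lo) (begin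
      x + l          ≡⟨ trans (+-comm x l) (sym balance) ⟩
      z + q          ≤⟨ +-monoʳ-≤ z q≤ ⟩
      z + (l + lo)   ≡⟨ x∙yz≈xz∙y z l lo ⟩
      z + lo + l     ∎) ,
  +-cancelʳ-≤ q z (x + hi) (begin
      z + q          ≡⟨ balance ⟩
      l + x          ≤⟨ +-monoˡ-≤ x l≤ ⟩
      q + hi + x     ≡⟨ xy∙z≈z∙yx q hi x ⟩
      x + (hi + q)   ≡⟨ +-assoc x hi q ⟨
      x + hi + q     ∎)
  where open ≤-Reasoning

-- Read in ℤ: the difference x − y increases by at least δ at every step.
module IncreasingDifference (x y : ℕ → ℕ) (δ : ℕ)
         (step : ∀ n → δ + x n + y (suc n) ≤ x (suc n) + y n) where

  strictMono-+ : ∀ m j → δ + x m + y (suc j + m) ≤ x (suc j + m) + y m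
  strictMono-+ m zero    = step m
  strictMono-+ m (suc j) = +-cancelʳ-≤ (δ + (x n + y n)) _ _ (begin
      δ + x m + y (suc n) + (δ + (x n + y n))  ≡⟨ shuffle₁ δ (x m) (y (suc n)) (x n) (y n) ⟩
      δ + x m + y n + (δ + x n + y (suc n))    ≤⟨ +-mono-≤ (strictMono-+ m j) (step n) ⟩
      x n + y m + (x (suc n) + y n)            ≡⟨ shuffle₂ (x n) (y m) (x (suc n)) (y n) ⟩
      x (suc n) + y m + (x n + y n)            ≤⟨ +-monoʳ-≤ (x (suc n) + y m) (m≤n+m (x n + y n) δ) ⟩
      x (suc n) + y m + (δ + (x n + y n))      ∎)
    where
    open ≤-Reasoning
    n = suc j + m
    shuffle₁ : ∀ d a b c e → d + a + b + (d + (c + e)) ≡ d + a + e + (d + c + b)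
    shuffle₁ = solve-∀
    shuffle₂ : ∀ a b c e → a + b + (c + e) ≡ c + b + (a + e)
    shuffle₂ = solve-∀

  strictMono : ∀ {m n} → m < n → δ + x m + y n ≤ x n + y m
  strictMono {m} (s≤s m≤n) with m≤n⇒∃[o]m+o≡n m≤n
  ... | j , refl = subst (λ n → δ + x m + y n ≤ x n + y m) (cong suc (+-comm j m)) (strictMono-+ m j)

  mono : ∀ {m n} → m ≤ n → x m + y n ≤ x n + y m
  mono m≤n with m≤n⇒m<n∨m≡n m≤n
  ... | inj₁ m<n  = ≤-trans (≤-trans (m≤n+m _ δ) (≤-reflexive (sym (+-assoc δ _ _)))) (strictMono m<n)
  ... | inj₂ refl = ≤-refl

module Windows (x y : ℕ → ℕ) (lo hi : ℕ)
         (step : ∀ n → suc (suc (lo + hi)) + x n + y (suc n) ≤ x (suc n) + y n) where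

  open IncreasingDifference x y (suc (suc (lo + hi))) step

  InWindow : ℕ → ℕ → Set
  InWindow c n = x n ≤ c + y n + lo × c + y n ≤ x n + hi

  upper-mono : ∀ {c h m} → h ≤ m → c + y h ≤ x h + hi → c + y m ≤ x m + hi
  upper-mono {c} {h} {m} h≤m upper = +-cancelʳ-≤ (y h) _ _ (begin
      c + y m + y h   ≡⟨ xy∙z≈xz∙y c (y m) (y h) ⟩
      c + y h + y m   ≤⟨ +-monoˡ-≤ (y m) upper ⟩
      x h + hi + y m  ≡⟨ xy∙z≈xz∙y (x h) hi (y m) ⟩
      x h + y m + hi  ≤⟨ +-monoˡ-≤ hi (mono h≤m) ⟩
      x m + y h + hi  ≡⟨ xy∙z≈xz∙y (x m) (y h) hi ⟩
      x m + hi + y h  ∎)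
    where open ≤-Reasoning

  lower-strict : ∀ {c h m} → m < h → x h ≤ c + y h + lo → suc (x m + hi) < c + y m
  lower-strict {c} {h} {m} m<h lower = +-cancelʳ-≤ (lo + y h) _ _ (begin
      suc (suc (x m + hi)) + (lo + y h)  ≡⟨ shuffle₁ (x m) hi lo (y h) ⟩
      suc (suc (lo + hi)) + x m + y h    ≤⟨ strictMono m<h ⟩
      x h + y m                          ≤⟨ +-monoˡ-≤ (y m) lower ⟩
      c + y h + lo + y m                 ≡⟨ shuffle₂ c (y h) lo (y m) ⟩
      c + y m + (lo + y h)               ∎)
    where
    open ≤-Reasoning
    shuffle₁ : ∀ a e l z → suc (suc (a + e)) + (l + z) ≡ suc (suc (l + e)) + a + z
    shuffle₁ = solve-∀
    shuffle₂ : ∀ a z l w → a + z + l + w ≡ a + w + (l + z)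
    shuffle₂ = solve-∀

  -- t is the first value above the window of m.
  window-gap : ∀ {c ĉ m n} → InWindow c m → InWindow ĉ n → m < n →
               ∃[ t ] (c ≤ t × t ≤ ĉ × ∀ h → ¬ InWindow t h)
  window-gap {c} {ĉ} {m} (_ , upper) (lower̂ , _) m<n = t , c≤t , t≤ĉ , outside
    where
    t = suc (x m + hi) ∸ y m
    t+y≡ : t + y m ≡ suc (x m + hi)
    t+y≡ = m∸n+n≡m (≤-trans (m≤n+m (y m) c) (≤-trans upper (n≤1+n _)))
    c≤t : c ≤ t
    c≤t = +-cancelʳ-≤ (y m) c t (≤-trans upper (≤-trans (n≤1+n _) (≤-reflexive (sym t+y≡))))
    t≤ĉ : t ≤ ĉ
    t≤ĉ = <⇒≤ (+-cancelʳ-< (y m) t ĉ (subst (_< ĉ + y m) (sym t+y≡) (lower-strict m<n lower̂)))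
    outside : ∀ h → ¬ InWindow t h
    outside h (lowerₕ , upperₕ) with h ≤? m
    ... | yes h≤m = 1+n≰n (subst (_≤ x m + hi) t+y≡ (upper-mono h≤m upperₕ))
    ... | no  h≰m = n≮n _ (subst (suc (x m + hi) <_) t+y≡ (lower-strict (≰⇒> h≰m) lowerₕ))

module Base (k : ℕ) where

  b : ℕ
  b = suc (suc k)

  s : ℕ → ℕ
  s n = sumSqDigitsFuel n b n

  sumSqDigitsFuel-zero : ∀ fuel → sumSqDigitsFuel fuel b 0 ≡ 0
  sumSqDigitsFuel-zero zero    = refl
  sumSqDigitsFuel-zero (suc _) = refl

  suc-/-≤ : ∀ n → suc n / b ≤ n
  suc-/-≤ n = s≤s⁻¹ (m/n<m (suc n) b (s≤s (s≤s z≤n)))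

  sumSqDigitsFuel-irrelevant : ∀ f g n → n ≤ f → n ≤ g →
                               sumSqDigitsFuel f b n ≡ sumSqDigitsFuel g b n
  sumSqDigitsFuel-irrelevant zero    g       zero    _ _ = sym (sumSqDigitsFuel-zero g)
  sumSqDigitsFuel-irrelevant (suc f) zero    zero    _ _ = refl
  sumSqDigitsFuel-irrelevant (suc f) (suc g) zero    _ _ = refl
  sumSqDigitsFuel-irrelevant (suc f) (suc g) (suc n) (s≤s n≤f) (s≤s n≤g) =
    cong (suc n % b * (suc n % b) +_)
         (sumSqDigitsFuel-irrelevant f g (suc n / b) (≤-trans (suc-/-≤ n) n≤f) (≤-trans (suc-/-≤ n) n≤g))

  sumSq-step : ∀ n → s n ≡ n % b * (n % b) + s (n / b)
  sumSq-step zero    = refl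
  sumSq-step (suc n) = cong (suc n % b * (suc n % b) +_)
    (sumSqDigitsFuel-irrelevant n (suc n / b) (suc n / b) (suc-/-≤ n) ≤-refl)

  sumSq-digit : ∀ r q → r < b → s (r + q * b) ≡ r * r + s q
  sumSq-digit r q r<b = trans (sumSq-step (r + q * b)) (cong₂ (λ d n → d * d + s n) last rest)
    where
    last : (r + q * b) % b ≡ r
    last = trans ([m+kn]%n≡m%n r q b) (m<n⇒m%n≡m r<b)
    rest : (r + q * b) / b ≡ q
    rest = trans (+-distrib-/-∣ʳ r (n∣m*n q)) (cong₂ _+_ (m<n⇒m/n≡0 r<b) (m*n/n≡m q b))

  SucBound : ℕ → Set
  SucBound n = s (suc n) ≤ s n + (k + suc k)

  sucBound-noCarry : ∀ r q → r ≤ k → SucBound (r + q * b)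
  sucBound-noCarry r q r≤k = begin
      s (suc r + q * b)          ≡⟨ sumSq-digit (suc r) q (s≤s (s≤s r≤k)) ⟩
      suc r * suc r + s q        ≡⟨ square-suc r (s q) ⟩
      r * r + s q + (r + suc r)  ≤⟨ +-monoʳ-≤ (r * r + s q) (+-mono-≤ r≤k (s≤s r≤k)) ⟩
      r * r + s q + (k + suc k)  ≡⟨ cong (_+ (k + suc k)) (sumSq-digit r q (s≤s (m≤n⇒m≤1+n r≤k))) ⟨
      s (r + q * b) + (k + suc k) ∎
    where
    open ≤-Reasoning
    square-suc : ∀ r z → suc r * suc r + z ≡ r * r + z + (r + suc r)
    square-suc = solve-∀

  sucBound-carry : ∀ q → SucBound q → SucBound (suc k + q * b)
  sucBound-carry q ih = begin
      s (0 + suc q * b)                     ≡⟨ sumSq-digit 0 (suc q) z<s ⟩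
      s (suc q)                             ≤⟨ ih ⟩
      s q + (k + suc k)                     ≤⟨ +-monoˡ-≤ (k + suc k) (m≤n+m (s q) (suc k * suc k)) ⟩
      suc k * suc k + s q + (k + suc k)     ≡⟨ cong (_+ (k + suc k)) (sumSq-digit (suc k) q ≤-refl) ⟨
      s (suc k + q * b) + (k + suc k)       ∎
    where open ≤-Reasoning

  sumSq-suc-≤ : ∀ n → SucBound n
  sumSq-suc-≤ = <-rec SucBound λ n rec → byLastDigit n rec (n % b ≤? k)
    where
    byLastDigit : ∀ n → (∀ {m} → m < n → SucBound m) → Dec (n % b ≤ k) → SucBound n
    byLastDigit n _ (yes r≤k) = subst SucBound (sym (m≡m%n+[m/n]*n n b)) (sucBound-noCarry (n % b) (n / b) r≤k)
    byLastDigit n rec (no r≰k) = subst SucBound (sym n≡) (sucBound-carry (n / b) (rec q<n))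
      where
      n≡ : n ≡ suc k + n / b * b
      n≡ = trans (m≡m%n+[m/n]*n n b)
                 (cong (_+ n / b * b) (≤-antisym (s≤s⁻¹ (m%n<n n b)) (≰⇒> r≰k)))
      q<n : n / b < n
      q<n = subst (n / b <_) (sym n≡) (s≤s (≤-trans (m≤m*n (n / b) b) (m≤n+m _ k)))

  C : ℕ
  C = b * (b * b)

  -- For digits d₀, d₁, d₂ < b these bound (d₀² + d₁² + d₂²) − (d₀ + d₁b + d₂b²) and its negative;
  -- with the largest step 2b − 3 of s they leave a gap of exactly 2 below b³ (cube-split).
  lowSlack highSlack : ℕ
  lowSlack  = k * suc k
  highSlack = suc k * b + suc k * (suc k * suc k + suc k + 1)

  slack-step : ∀ n → suc (suc (lowSlack + highSlack)) + C * n + s (suc n) ≤ C * suc n + s n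
  slack-step n = begin
      G + C * n + s (suc n)            ≤⟨ +-monoʳ-≤ (G + C * n) (sumSq-suc-≤ n) ⟩
      G + C * n + (s n + (k + suc k))  ≡⟨ shuffle G (C * n) (s n) (k + suc k) ⟩
      G + (k + suc k) + C * n + s n    ≡⟨ cong (λ c → c + C * n + s n) (cube-split k) ⟩
      C + C * n + s n                  ≡⟨ cong (_+ s n) (*-suc C n) ⟨
      C * suc n + s n                  ∎
    where
    open ≤-Reasoning
    G = suc (suc (lowSlack + highSlack))
    shuffle : ∀ g c z w → g + c + (z + w) ≡ g + w + c + z
    shuffle = solve-∀
    cube-split : ∀ k → suc (suc (k * suc k + (suc k * suc (suc k) + suc k * (suc k * suc k + suc k + 1))))
                         + (k + suc k) ≡ suc (suc k) * (suc (suc k) * suc (suc k))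
    cube-split = solve-∀

  open Windows (C *_) s lowSlack highSlack slack-step

  lowDigits-lower : ∀ {d₀ d₁ d₂} → d₀ ≤ suc k → d₁ ≤ suc k → d₂ ≤ suc k →
    d₀ * d₀ + d₁ * d₁ + d₂ * d₂ ≤ d₀ + d₁ * b + d₂ * (b * b) + lowSlack
  lowDigits-lower {d₀} {d₁} {d₂} d₀≤ d₁≤ d₂≤ = begin
      d₀ * d₀ + d₁ * d₁ + d₂ * d₂                ≤⟨ +-mono-≤ (+-mono-≤ (square≤ d₀ d₀≤) (*-monoʳ-≤ d₁ (m≤n⇒m≤1+n d₁≤)))
                                                              (*-monoʳ-≤ d₂ (≤-trans (m≤n⇒m≤1+n d₂≤) (m≤m*n b b))) ⟩
      d₀ + lowSlack + d₁ * b + d₂ * (b * b)      ≡⟨ shuffle d₀ lowSlack (d₁ * b) (d₂ * (b * b)) ⟩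
      d₀ + d₁ * b + d₂ * (b * b) + lowSlack      ∎
    where
    open ≤-Reasoning
    square≤ : ∀ d → d ≤ suc k → d * d ≤ d + k * suc k
    square≤ zero    _         = z≤n
    square≤ (suc d) (s≤s d≤k) = +-monoʳ-≤ (suc d) (*-mono-≤ d≤k (s≤s d≤k))
    shuffle : ∀ a l c e → a + l + c + e ≡ a + c + e + l
    shuffle = solve-∀

  lowDigits-upper : ∀ {d₀ d₁ d₂} → d₁ ≤ suc k → d₂ ≤ suc k →
    d₀ + d₁ * b + d₂ * (b * b) ≤ d₀ * d₀ + d₁ * d₁ + d₂ * d₂ + highSlack
  lowDigits-upper {d₀} {d₁} {d₂} d₁≤ d₂≤ = begin
      d₀ + d₁ * b + d₂ * (b * b)  ≤⟨ +-mono-≤ (+-mono-≤ (≤-square d₀) (≤-trans (*-monoˡ-≤ b d₁≤) (m≤n+m _ (d₁ * d₁))))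
                                              (timesSquare≤ d₂≤) ⟩
      d₀ * d₀ + (d₁ * d₁ + suc k * b) + (d₂ * d₂ + suc k * (suc k * suc k + suc k + 1))
                                   ≡⟨ shuffle (d₀ * d₀) (d₁ * d₁) (d₂ * d₂) (suc k * b) _ ⟩
      d₀ * d₀ + d₁ * d₁ + d₂ * d₂ + highSlack ∎
    where
    open ≤-Reasoning
    ≤-square : ∀ d → d ≤ d * d
    ≤-square zero    = z≤n
    ≤-square (suc d) = m≤m*n (suc d) (suc d)
    -- With d + r = b − 1 this is an identity between polynomials in d and r.
    timesSquare≤ : ∀ {d} → d ≤ suc k → d * (b * b) ≤ d * d + suc k * (suc k * suc k + suc k + 1)
    timesSquare≤ {d} d≤ with m≤n⇒∃[o]m+o≡n d≤
    ... | r , d+r≡ = subst (λ p → d * (suc p * suc p) ≤ d * d + p * (p * p + p + 1)) d+r≡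
                           (≤-trans (m≤m+n _ _) (≤-reflexive (expand d r)))
      where
      expand : ∀ d r → d * (suc (d + r) * suc (d + r)) + r * ((d + r) * (d + r) + r + 1)
                     ≡ d * d + (d + r) * ((d + r) * (d + r) + (d + r) + 1)
      expand = solve-∀
    shuffle : ∀ a c e u v → a + (c + u) + (e + v) ≡ a + c + e + (u + v)
    shuffle = solve-∀

  head : ℕ → ℕ
  head a = a / b / b / b

  expansion₃ : ∀ a → a ≡ a % b + a / b % b * b + a / b / b % b * (b * b) + C * head a
  expansion₃ a = begin
      a                                           ≡⟨ m≡m%n+[m/n]*n a b ⟩
      d₀ + a / b * b                              ≡⟨ cong (λ n → d₀ + n * b) (m≡m%n+[m/n]*n (a / b) b) ⟩
      d₀ + (d₁ + a / b / b * b) * b               ≡⟨ cong (λ n → d₀ + (d₁ + n * b) * b) (m≡m%n+[m/n]*n (a / b / b) b) ⟩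
      d₀ + (d₁ + (d₂ + head a * b) * b) * b       ≡⟨ regroup d₀ d₁ d₂ (head a) b ⟩
      d₀ + d₁ * b + d₂ * (b * b) + C * head a     ∎
    where
    open ≡-Reasoning
    d₀ = a % b
    d₁ = a / b % b
    d₂ = a / b / b % b
    regroup : ∀ d₀ d₁ d₂ h b → d₀ + (d₁ + (d₂ + h * b) * b) * b ≡ d₀ + d₁ * b + d₂ * (b * b) + b * (b * b) * h
    regroup = solve-∀

  sumSq-expansion₃ : ∀ a → s a ≡ a % b * (a % b) + a / b % b * (a / b % b) + a / b / b % b * (a / b / b % b) + s (head a)
  sumSq-expansion₃ a = begin
      s a                                        ≡⟨ sumSq-step a ⟩
      d₀ * d₀ + s (a / b)                        ≡⟨ cong (d₀ * d₀ +_) (sumSq-step (a / b)) ⟩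
      d₀ * d₀ + (d₁ * d₁ + s (a / b / b))        ≡⟨ cong (λ n → d₀ * d₀ + (d₁ * d₁ + n)) (sumSq-step (a / b / b)) ⟩
      d₀ * d₀ + (d₁ * d₁ + (d₂ * d₂ + s (head a))) ≡⟨ regroup (d₀ * d₀) (d₁ * d₁) (d₂ * d₂) (s (head a)) ⟩
      d₀ * d₀ + d₁ * d₁ + d₂ * d₂ + s (head a)   ∎
    where
    open ≡-Reasoning
    d₀ = a % b
    d₁ = a / b % b
    d₂ = a / b / b % b
    regroup : ∀ x y z w → x + (y + (z + w)) ≡ x + y + z + w
    regroup = solve-∀

  fixedPoint-window : ∀ {c a} → c + s a ≡ a → InWindow c (head a)
  fixedPoint-window {c} {a} fixed =
    bounds-from-balance balance (lowDigits-lower d₀≤ d₁≤ d₂≤) (lowDigits-upper d₁≤ d₂≤)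
    where
    d₀ = a % b
    d₁ = a / b % b
    d₂ = a / b / b % b
    digit≤ : ∀ n → n % b ≤ suc k
    digit≤ n = s≤s⁻¹ (m%n<n n b)
    d₀≤ = digit≤ a
    d₁≤ = digit≤ (a / b)
    d₂≤ = digit≤ (a / b / b)
    regroup : ∀ c h x y z → c + h + (x + y + z) ≡ c + (x + y + z + h)
    regroup = solve-∀
    balance : c + s (head a) + (d₀ * d₀ + d₁ * d₁ + d₂ * d₂) ≡ d₀ + d₁ * b + d₂ * (b * b) + C * head a
    balance = begin
        c + s (head a) + (d₀ * d₀ + d₁ * d₁ + d₂ * d₂) ≡⟨ regroup c (s (head a)) (d₀ * d₀) (d₁ * d₁) (d₂ * d₂) ⟩
        c + (d₀ * d₀ + d₁ * d₁ + d₂ * d₂ + s (head a)) ≡⟨ cong (c +_) (sumSq-expansion₃ a) ⟨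
        c + s a                                        ≡⟨ fixed ⟩
        a                                              ≡⟨ expansion₃ a ⟩
        d₀ + d₁ * b + d₂ * (b * b) + C * head a        ∎
      where open ≡-Reasoning

  fixedPoint-heads-≮ : ∀ {c ĉ a â} → InCommonOasis b c ĉ → c + s a ≡ a → ĉ + s â ≡ â →
                       ¬ head a < head â
  fixedPoint-heads-≮ oasis fixed fixed̂ lt
    with window-gap (fixedPoint-window fixed) (fixedPoint-window fixed̂) lt
  ... | t , c≤t , t≤ĉ , outside with oasis t (inj₁ (c≤t , t≤ĉ))
  ... | a′ , _ , fixed′ = outside (head a′) (fixedPoint-window fixed′)

  fixedPoint-heads-≡ : ∀ {c ĉ a â} → InCommonOasis b c ĉ → c + s a ≡ a → ĉ + s â ≡ â →
                       head a ≡ head â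
  fixedPoint-heads-≡ oasis fixed fixed̂ = ≤-antisym
    (≮⇒≥ (fixedPoint-heads-≮ (InCommonOasis-sym oasis) fixed̂ fixed))
    (≮⇒≥ (fixedPoint-heads-≮ oasis fixed fixed̂))
    where
    InCommonOasis-sym : ∀ {c ĉ} → InCommonOasis b c ĉ → InCommonOasis b ĉ c
    InCommonOasis-sym oasis t = oasis t ∘ swap

theorem6 : (b c ĉ a â : ℕ) → 2 ≤ b → InCommonOasis b c ĉ →
    IsFixedPoint c b a → IsFixedPoint ĉ b â →
    (i : ℕ) → 3 ≤ i → digit b i a ≡ digit b i â
theorem6 (suc (suc k)) c ĉ a â _ oasis (_ , fixed) (_ , fixed̂) (suc (suc (suc i))) _ =
  cong (digit (suc (suc k)) i) (Base.fixedPoint-heads-≡ k oasis fixed fixed̂)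
theorem6 zero          _ _ _ _ ()        _ _ _ _                   _
theorem6 (suc zero)    _ _ _ _ (s≤s ()) _ _ _ _                   _
theorem6 (suc (suc k)) _ _ _ _ _         _ _ _ zero                ()
theorem6 (suc (suc k)) _ _ _ _ _         _ _ _ (suc zero)          (s≤s ())
theorem6 (suc (suc k)) _ _ _ _ _         _ _ _ (suc (suc zero))    (s≤s (s≤s ()))
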